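{- Let $n\ge3$, let $\mathcal{I}\subseteq\{1,\ldots,n-1\}$ with $1\in\mathcal{I}$, let $\Gamma$ be the pregraph $2_{\mathcal{I}}^n$ with vertices $u,v$, and let $G$, $z,z',y_2,\ldots,y_{n-1}$ and $\zeta:D(\Gamma)\to G$ be as follows: $G$ is a group generated by $z,z',y_2,\ldots,y_{n-1}$ with $z^2=(z')^2=y_i^2=1_G$; for $i\in\{3,\ldots,n-1\}$, $y_i^{ -1}zy_i=z$ and $y_i^{ -1}z'y_i=z'$ if $i\in\mathcal{I}$, while $y_i^{ -1}zy_i=z'$ and $y_i^{ -1}z'y_i=z$ if $i\notin\mathcal{I}$; $y_iy_j=y_jy_i$ whenever $|i-j|>1$; and $\zeta(u_0)=1_G$, $\zeta(u_1)=z$, $\zeta(v_1)=z'$, $\zeta(u_i)=\zeta(v_i)=y_i$ for $i\ge2$. Let $R$ be the colour-preserving automorphism of $\Gamma$ interchanging its two vertices. If no automorphism of $G$ interchanges $z$ and $z'$ while fixing $y_i$ for every $i\in\{2,\ldots,n-1\}$, then $R$ does not lift to an automorphism of $\mathrm{Cov}(\Gamma,\zeta)$, i.e. there is no automorphism $\tilde R$ of $\mathrm{Cov}(\Gamma,\zeta)$ with $\wp\circ\tilde R=R\circ\wp$, where $\wp$ is the projection $(x,a)\mapsto x$.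
   Context: A pregraph is a tuple $(V,D;\mathrm{beg},\mathrm{inv})$ with disjoint finite sets $V$ and $D$ (darts), a map $\mathrm{beg}:D\to V$ and an involution $\mathrm{inv}:D\to D$; an automorphism is a permutation of $V\cup D$ preserving $V$ and $D$ and commuting with $\mathrm{beg}$ and $\mathrm{inv}$. For $\mathcal{I}\subseteq\{0,\ldots,n-1\}$, $2_{\mathcal{I}}^n$ is the coloured pregraph with two vertices $u,v$ and, for each colour $i$, one dart $u_i$ starting at $u$ and one dart $v_i$ starting at $v$, both of colour $i$, with $\mathrm{inv}(u_i)=u_i$, $\mathrm{inv}(v_i)=v_i$ if $i\in\mathcal{I}$ and $\mathrm{inv}(u_i)=v_i$ otherwise; $R$ maps $u\mapsto v$, $u_i\mapsto v_i$ and vice versa. A voltage assignment satisfies $\zeta(\mathrm{inv}\,x)=\zeta(x)^{ -1}$. $\mathrm{Cov}(\Gamma,\zeta)$ has darts $D\times G$, vertices $V\times G$, $\mathrm{beg}(x,a)=(\mathrm{beg}\,x,a)$, $\mathrm{inv}(x,a)=(\mathrm{inv}\,x,\zeta(x)a)$, and projection $\wp(x,a)=x$, $\wp(w,a)=w$. -}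

module Defs where

open import Level using (Level; _⊔_; suc)
open import Algebra.Bundles using (Group)
open import Algebra.Morphism.Structures using (module GroupMorphisms)
open import Data.Fin using (Fin; toℕ)
open import Data.Fin.Subset using (Subset)
open import Data.Fin.Subset.Properties using (_∈?_)
open import Data.Nat using (ℕ)
open import Data.Product using (_×_; _,_; proj₁; proj₂)
open import Data.Product.Relation.Binary.Pointwise.NonDependent using (×-setoid)
open import Function.Bundles using (Inverse)
open import Relation.Binary.Bundles using (Setoid)
open import Relation.Binary.PropositionalEquality as ≡ using (_≡_; refl)
open import Relation.Nullary using (yes; no)

record Pregraph : Set₁ where
  field
    V D       : Set
    beg       : D → V
    inv       : D → D
    inv-invol : ∀ x → inv (inv x) ≡ x

-- The pregraph 2^n_I.  Vertices u, v; darts (s , i) = s_i of colour i.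

data Vtx : Set where
  u v : Vtx

swapV : Vtx → Vtx
swapV u = v
swapV v = u

swapV-invol : ∀ s → swapV (swapV s) ≡ s
swapV-invol u = refl
swapV-invol v = refl

module Two (n : ℕ) (I : Subset n) where

  Dart : Set
  Dart = Vtx × Fin n

  beg₂ : Dart → Vtx
  beg₂ (s , i) = s

  inv₂ : Dart → Dart
  inv₂ (s , i) with i ∈? I
  ... | yes _ = (s , i)
  ... | no  _ = (swapV s , i)

  inv₂-invol : ∀ x → inv₂ (inv₂ x) ≡ x
  inv₂-invol (s , i) with i ∈? I
  ... | yes p with i ∈? I
  ...   | yes _ = refl
  ...   | no ¬p = Data.Empty.⊥-elim (¬p p)
    where import Data.Empty
  inv₂-invol (s , i) | no ¬p with i ∈? I
  ...   | yes p = Data.Empty.⊥-elim (¬p p)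
    where import Data.Empty
  ...   | no _ = ≡.cong (_, i) (swapV-invol s)

  RV : Vtx → Vtx
  RV = swapV

  RD : Dart → Dart
  RD (s , i) = (swapV s , i)

two : (n : ℕ) → Subset n → Pregraph
two n I = record
  { V = Vtx ; D = Two.Dart n I ; beg = Two.beg₂ n I
  ; inv = Two.inv₂ n I ; inv-invol = Two.inv₂-invol n I }

module _ {c ℓ : Level} (Γ : Pregraph) (G : Group c ℓ) where
  open Pregraph Γ
  open Group G renaming (Carrier to A)

  record Voltage : Set (c ⊔ ℓ) where
    field
      ζ     : D → A
      ζ-inv : ∀ x → ζ (inv x) ≈ ζ x ⁻¹

  CovV : Setoid c ℓ
  CovV = ×-setoid (≡.setoid V) setoid

  CovD : Setoid c ℓ
  CovD = ×-setoid (≡.setoid D) setoid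

  module _ (ζv : Voltage) where
    open Voltage ζv

    covBeg : D × A → V × A
    covBeg (x , a) = (beg x , a)

    covInv : D × A → D × A
    covInv (x , a) = (inv x , ζ x ∙ a)

    record CovAut : Set (c ⊔ ℓ) where
      field
        autV   : Inverse CovV CovV
        autD   : Inverse CovD CovD
        commBeg : ∀ x → Setoid._≈_ CovV (covBeg (Inverse.to autD x))
                                        (Inverse.to autV (covBeg x))
        commInv : ∀ x → Setoid._≈_ CovD (covInv (Inverse.to autD x))
                                        (Inverse.to autD (covInv x))

module _ {c ℓ : Level} (G : Group c ℓ) where
  open Group G
  open GroupMorphisms rawGroup rawGroup

  record GroupAut : Set (c ⊔ ℓ) where
    field
      f     : Carrier → Carrier
      isIso : IsGroupIsomorphism f

  data Generated (S : Carrier → Set ℓ) : Carrier → Set (c ⊔ ℓ) where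
    gen   : ∀ {x} → S x → Generated S x
    unit  : Generated S ε
    mul   : ∀ {x y} → Generated S x → Generated S y → Generated S (x ∙ y)
    invs  : ∀ {x} → Generated S x → Generated S (x ⁻¹)
    resp  : ∀ {x y} → x ≈ y → Generated S x → Generated S y

-- A lift R̃ of R maps the fibre over u to the fibre over v by a bijection g of G.
-- Commutation with inv along the dart u₀ (not a loop, trivial voltage) shows that
-- R̃ maps the fibre over v back by the same g, and then commutation with inv along
-- any dart x gives g (ζ x ∙ a) ≈ ζ (R x) ∙ g a.  So g (a ∙ b) ≈ k ∙ g b for
-- (a , k) = (z , z'), (z' , z), (yᵢ , yᵢ); this property is closed under products
-- and inverses, hence holds on all of G, where k is forced to be
-- φ a = g a ∙ (g ε)⁻¹.  Then φ is an automorphism swapping z and z' and fixing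
-- every yᵢ.  None of the defining relations of G is used.
module Submission where

open import Defs
open import Level using (Level; _⊔_)
open import Algebra.Bundles using (Group)
open import Algebra.Morphism.Structures using (module GroupMorphisms)
import Algebra.Properties.Group as GroupProperties
open import Data.Fin as Fin using (Fin; toℕ)
open import Data.Fin.Subset using (Subset; _∈_; _∉_)
open import Data.Fin.Subset.Properties using (_∈?_)
open import Data.Nat using (ℕ; suc; _≤_; _<_; ∣_-_∣; s≤s)
open import Data.Product using (Σ; ∃; ∃₂; _×_; _,_; proj₁; proj₂)
open import Data.Sum using (_⊎_; inj₁; inj₂)
open import Function.Bundles using (Inverse; Injection)
open import Function.Definitions using (Injective; StrictlySurjective)
open import Function.Consequences using (strictlySurjective⇒surjective)
open import Function.Properties.Inverse using (Inverse⇒Injection)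
import Relation.Binary.Reasoning.Setoid as SetoidReasoning
open import Relation.Binary.PropositionalEquality as ≡ using (_≡_)
open import Relation.Nullary using (¬_; yes; no)
open import Relation.Nullary.Negation using (contradiction)

module Intertwining {c ℓ : Level} (G : Group c ℓ) (g : Group.Carrier G → Group.Carrier G)
  (g-cong : ∀ {a b} → Group._≈_ G a b → Group._≈_ G (g a) (g b)) where
  open Group G
  open GroupProperties G using (//-rightDividesʳ; ∙-cancelʳ)
  open SetoidReasoning setoid

  Intertwines : Carrier → Carrier → Set (c ⊔ ℓ)
  Intertwines a k = ∀ b → g (a ∙ b) ≈ k ∙ g b

  φ : Carrier → Carrier
  φ a = g a // g ε

  φ-cong : ∀ {a b} → a ≈ b → φ a ≈ φ b
  φ-cong a≈b = ∙-congʳ (g-cong a≈b)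

  g≈⇒φ≈ : ∀ {a k} → g a ≈ k ∙ g ε → φ a ≈ k
  g≈⇒φ≈ {a} {k} ga≈kgε = begin
    g a // g ε         ≈⟨ ∙-congʳ ga≈kgε ⟩
    k ∙ g ε // g ε     ≈⟨ //-rightDividesʳ (g ε) k ⟩
    k                  ∎

  intertwines⇒φ≈ : ∀ {a k} → Intertwines a k → φ a ≈ k
  intertwines⇒φ≈ {a} {k} a⋈k = g≈⇒φ≈ (trans (g-cong (sym (identityʳ a))) (a⋈k ε))

  resp-intertwines : ∀ {a a' k k'} → a ≈ a' → k ≈ k' → Intertwines a k → Intertwines a' k'
  resp-intertwines a≈a' k≈k' a⋈k b = trans (g-cong (∙-congʳ (sym a≈a'))) (trans (a⋈k b) (∙-congʳ k≈k'))

  ε-intertwines : Intertwines ε ε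
  ε-intertwines b = trans (g-cong (identityˡ b)) (sym (identityˡ (g b)))

  ∙-intertwines : ∀ {a a' k k'} → Intertwines a k → Intertwines a' k' →
                  Intertwines (a ∙ a') (k ∙ k')
  ∙-intertwines {a} {a'} {k} {k'} a⋈k a'⋈k' b = begin
    g (a ∙ a' ∙ b)     ≈⟨ g-cong (assoc a a' b) ⟩
    g (a ∙ (a' ∙ b))   ≈⟨ a⋈k (a' ∙ b) ⟩
    k ∙ g (a' ∙ b)     ≈⟨ ∙-congˡ (a'⋈k' b) ⟩
    k ∙ (k' ∙ g b)     ≈⟨ assoc k k' (g b) ⟨
    k ∙ k' ∙ g b       ∎

  ⁻¹-intertwines : ∀ {a k} → Intertwines a k → Intertwines (a ⁻¹) (k ⁻¹)
  ⁻¹-intertwines {a} {k} a⋈k b = begin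
    g (a ⁻¹ ∙ b)                 ≈⟨ identityˡ _ ⟨
    ε ∙ g (a ⁻¹ ∙ b)             ≈⟨ ∙-congʳ (inverseˡ k) ⟨
    k ⁻¹ ∙ k ∙ g (a ⁻¹ ∙ b)      ≈⟨ assoc (k ⁻¹) k _ ⟩
    k ⁻¹ ∙ (k ∙ g (a ⁻¹ ∙ b))    ≈⟨ ∙-congˡ (a⋈k (a ⁻¹ ∙ b)) ⟨
    k ⁻¹ ∙ g (a ∙ (a ⁻¹ ∙ b))    ≈⟨ ∙-congˡ (g-cong (assoc a (a ⁻¹) b)) ⟨
    k ⁻¹ ∙ g (a ∙ a ⁻¹ ∙ b)      ≈⟨ ∙-congˡ (g-cong (trans (∙-congʳ (inverseʳ a)) (identityˡ b))) ⟩
    k ⁻¹ ∙ g b                   ∎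

  generated-intertwines : ∀ {S : Carrier → Set ℓ} → (∀ {s} → S s → ∃ (Intertwines s)) →
                          ∀ {a} → Generated G S a → ∃ (Intertwines a)
  generated-intertwines gens (gen s)     = gens s
  generated-intertwines gens unit        = ε , ε-intertwines
  generated-intertwines gens (mul p q)   with generated-intertwines gens p | generated-intertwines gens q
  ... | k , a⋈k | k' , a'⋈k' = k ∙ k' , ∙-intertwines a⋈k a'⋈k'
  generated-intertwines gens (invs p)    with generated-intertwines gens p
  ... | k , a⋈k = k ⁻¹ , ⁻¹-intertwines a⋈k
  generated-intertwines gens (resp eq p) with generated-intertwines gens p
  ... | k , a⋈k = k , resp-intertwines eq refl a⋈k

  module _ (intertwined : ∀ a → ∃ (Intertwines a))
           (g-injective : Injective _≈_ _≈_ g) (g-surjective : StrictlySurjective _≈_ g) where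
    open GroupMorphisms rawGroup rawGroup

    φ-homo : ∀ a b → φ (a ∙ b) ≈ φ a ∙ φ b
    φ-homo a b with intertwined a | intertwined b
    ... | k , a⋈k | k' , b⋈k' =
      trans (intertwines⇒φ≈ (∙-intertwines a⋈k b⋈k'))
            (sym (∙-cong (intertwines⇒φ≈ a⋈k) (intertwines⇒φ≈ b⋈k')))

    φ-⁻¹-homo : ∀ a → φ (a ⁻¹) ≈ φ a ⁻¹
    φ-⁻¹-homo a with intertwined a
    ... | k , a⋈k = trans (intertwines⇒φ≈ (⁻¹-intertwines a⋈k)) (sym (⁻¹-cong (intertwines⇒φ≈ a⋈k)))

    φ-injective : Injective _≈_ _≈_ φ
    φ-injective {a} {b} φa≈φb = g-injective (∙-cancelʳ (g ε ⁻¹) (g a) (g b) φa≈φb)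

    φ-strictlySurjective : StrictlySurjective _≈_ φ
    φ-strictlySurjective k with g-surjective (k ∙ g ε)
    ... | a , ga≈kgε = a , g≈⇒φ≈ ga≈kgε

    φ-isGroupIsomorphism : IsGroupIsomorphism φ
    φ-isGroupIsomorphism = record
      { isGroupMonomorphism = record
        { isGroupHomomorphism = record
          { isMonoidHomomorphism = record
            { isMagmaHomomorphism = record
              { isRelHomomorphism = record { cong = φ-cong }
              ; homo = φ-homo }
            ; ε-homo = intertwines⇒φ≈ ε-intertwines }
          ; ⁻¹-homo = φ-⁻¹-homo }
        ; injective = φ-injective }
      ; surjective = strictlySurjective⇒surjective trans φ-cong φ-strictlySurjective }

    φ-aut : GroupAut G
    φ-aut = record { f = φ ; isIso = φ-isGroupIsomorphism }

module LiftedAutomorphism {c ℓ : Level} (Γ : Pregraph) (G : Group c ℓ) (ζv : Voltage Γ G)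
  (R̃ : CovAut Γ G ζv) (RV : Pregraph.V Γ → Pregraph.V Γ) (RD : Pregraph.D Γ → Pregraph.D Γ)
  (over-RV : ∀ w → proj₁ (Inverse.to (CovAut.autV R̃) w) ≡ RV (proj₁ w))
  (over-RD : ∀ x → proj₁ (Inverse.to (CovAut.autD R̃) x) ≡ RD (proj₁ x)) where
  open Pregraph Γ
  open Group G
  open Voltage ζv
  open CovAut R̃
  open SetoidReasoning setoid

  lift : V → Carrier → Carrier
  lift w a = proj₂ (Inverse.to autV (w , a))

  lift-cong : ∀ w {a b} → a ≈ b → lift w a ≈ lift w b
  lift-cong w a≈b = proj₂ (Inverse.to-cong autV (≡.refl , a≈b))

  lift-voltage : ∀ x a → ζ (RD x) ∙ lift (beg x) a ≈ lift (beg (inv x)) (ζ x ∙ a)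
  lift-voltage x a = begin
    ζ (RD x) ∙ lift (beg x) a                 ≈⟨ ∙-cong (reflexive (≡.cong ζ (≡.sym (over-RD (x , a)))))
                                                         (sym (proj₂ (commBeg (x , a)))) ⟩
    ζ (proj₁ x̃) ∙ proj₂ x̃                     ≈⟨ proj₂ (commInv (x , a)) ⟩
    proj₂ (Inverse.to autD (inv x , ζ x ∙ a)) ≈⟨ proj₂ (commBeg (inv x , ζ x ∙ a)) ⟩
    lift (beg (inv x)) (ζ x ∙ a)              ∎
    where x̃ = Inverse.to autD (x , a)

  lift-injective : ∀ w {a b} → lift w a ≈ lift w b → a ≈ b
  lift-injective w {a} {b} eq =
    proj₂ (Injection.injective (Inverse⇒Injection autV)
             (≡.trans (over-RV (w , a)) (≡.sym (over-RV (w , b))) , eq))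

  lift-onto : ∀ w' k → ∃₂ λ w a → RV w ≡ w' × lift w a ≈ k
  lift-onto w' k = proj₁ p , proj₂ p , ≡.trans (≡.sym (over-RV p)) (proj₁ to-p≈) , proj₂ to-p≈
    where
    p = Inverse.from autV (w' , k)
    to-p≈ = Inverse.strictlyInverseˡ autV (w' , k)

inv₂-∉ : ∀ n (I : Subset n) s {i} → i ∉ I → Two.inv₂ n I (s , i) ≡ (swapV s , i)
inv₂-∉ n I s {i} i∉I with i ∈? I
... | yes i∈I = contradiction i∈I i∉I
... | no _    = ≡.refl

module LiftOfSwap {c ℓ : Level} (n : ℕ) (I : Subset n) (G : Group c ℓ) (ζv : Voltage (two n I) G)
  (R̃ : CovAut (two n I) G ζv)
  (over-RV : ∀ w → proj₁ (Inverse.to (CovAut.autV R̃) w) ≡ Two.RV n I (proj₁ w))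
  (over-RD : ∀ x → proj₁ (Inverse.to (CovAut.autD R̃) x) ≡ Two.RD n I (proj₁ x))
  (i₀ : Fin n) (i₀∉I : i₀ ∉ I) (ζ-u₀ : Group._≈_ G (Voltage.ζ ζv (u , i₀)) (Group.ε G)) where
  open Group G
  open GroupProperties G using (ε⁻¹≈ε)
  open Voltage ζv
  open LiftedAutomorphism (two n I) G ζv R̃ swapV (Two.RD n I) over-RV over-RD
  open SetoidReasoning setoid

  ζ-v₀ : ζ (v , i₀) ≈ ε
  ζ-v₀ = begin
    ζ (v , i₀)                    ≈⟨ reflexive (≡.cong ζ (inv₂-∉ n I u i₀∉I)) ⟨
    ζ (Two.inv₂ n I (u , i₀))     ≈⟨ ζ-inv (u , i₀) ⟩
    ζ (u , i₀) ⁻¹                 ≈⟨ ⁻¹-cong ζ-u₀ ⟩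
    ε ⁻¹                          ≈⟨ ε⁻¹≈ε ⟩
    ε                             ∎

  lift-v≈lift-u : ∀ a → lift v a ≈ lift u a
  lift-v≈lift-u a = begin
    lift v a                                              ≈⟨ lift-cong v (trans (∙-congʳ ζ-u₀) (identityˡ a)) ⟨
    lift v (ζ (u , i₀) ∙ a)                               ≡⟨ ≡.cong (λ x → lift (proj₁ x) (ζ (u , i₀) ∙ a))
                                                                  (inv₂-∉ n I u i₀∉I) ⟨
    lift (proj₁ (Two.inv₂ n I (u , i₀))) (ζ (u , i₀) ∙ a) ≈⟨ lift-voltage (u , i₀) a ⟨
    ζ (v , i₀) ∙ lift u a                                 ≈⟨ trans (∙-congʳ ζ-v₀) (identityˡ _) ⟩
    lift u a                                              ∎

  g : Carrier → Carrier
  g = lift u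

  lift≈g : ∀ w a → lift w a ≈ g a
  lift≈g u a = refl
  lift≈g v a = lift-v≈lift-u a

  open Intertwining G g (lift-cong u) public

  voltage-intertwines : ∀ s i → Intertwines (ζ (s , i)) (ζ (swapV s , i))
  voltage-intertwines s i a = begin
    g (ζ (s , i) ∙ a)                                   ≈⟨ lift≈g _ _ ⟨
    lift (proj₁ (Two.inv₂ n I (s , i))) (ζ (s , i) ∙ a) ≈⟨ lift-voltage (s , i) a ⟨
    ζ (swapV s , i) ∙ lift s a                          ≈⟨ ∙-congˡ (lift≈g s a) ⟩
    ζ (swapV s , i) ∙ g a                               ∎

  g-injective : Injective _≈_ _≈_ g
  g-injective = lift-injective u

  g-surjective : StrictlySurjective _≈_ g
  g-surjective k with lift-onto v k
  ... | u , a , _ , ga≈k = a , ga≈k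
  ... | v , _ , () , _

proposition17 : ∀ {c ℓ : Level} (n : ℕ) → 3 ≤ n →
    (I : Subset n) → (∀ i → toℕ i ≡ 0 → i ∉ I) → (∀ i → toℕ i ≡ 1 → i ∈ I) →
    (G : Group c ℓ) →
    let open Group G in
    (z z' : Carrier) (y : Fin n → Carrier) →
    (∀ g → Generated G (λ x → x ≈ z ⊎ x ≈ z' ⊎ Σ (Fin n) (λ i → 2 ≤ toℕ i × x ≈ y i)) g) →
    z ∙ z ≈ ε → z' ∙ z' ≈ ε → (∀ i → 2 ≤ toℕ i → y i ∙ y i ≈ ε) →
    (∀ i → 3 ≤ toℕ i → i ∈ I → (y i ⁻¹ ∙ z ∙ y i ≈ z) × (y i ⁻¹ ∙ z' ∙ y i ≈ z')) →
    (∀ i → 3 ≤ toℕ i → i ∉ I → (y i ⁻¹ ∙ z ∙ y i ≈ z') × (y i ⁻¹ ∙ z' ∙ y i ≈ z)) →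
    (∀ i j → 2 ≤ toℕ i → 2 ≤ toℕ j → 1 < ∣ toℕ i - toℕ j ∣ → y i ∙ y j ≈ y j ∙ y i) →
    (ζ : Voltage (two n I) G) →
    (∀ i → toℕ i ≡ 0 → Voltage.ζ ζ (u , i) ≈ ε) →
    (∀ i → toℕ i ≡ 1 → Voltage.ζ ζ (u , i) ≈ z) →
    (∀ i → toℕ i ≡ 1 → Voltage.ζ ζ (v , i) ≈ z') →
    (∀ i → 2 ≤ toℕ i → (Voltage.ζ ζ (u , i) ≈ y i) × (Voltage.ζ ζ (v , i) ≈ y i)) →
    -- no automorphism of G swaps z and z' while fixing every y_i (i ≥ 2)
    ¬ (Σ (GroupAut G) λ φ →
         (GroupAut.f φ z ≈ z') × (GroupAut.f φ z' ≈ z) ×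
         (∀ i → 2 ≤ toℕ i → GroupAut.f φ (y i) ≈ y i)) →
    -- then R does not lift: no automorphism R̃ of Cov(Γ,ζ) with ℘ ∘ R̃ = R ∘ ℘
    ¬ (Σ (CovAut (two n I) G ζ) λ R̃ →
         (∀ w → proj₁ (Inverse.to (CovAut.autV R̃) w) ≡ Two.RV n I (proj₁ w)) ×
         (∀ x → proj₁ (Inverse.to (CovAut.autD R̃) x) ≡ Two.RD n I (proj₁ x)))
proposition17 {ℓ = ℓ} n@(suc (suc (suc _))) (s≤s (s≤s (s≤s _))) I 0∉I _ G z z' y generated _ _ _ _ _ _
              ζv ζ-u₀ ζ-u₁ ζ-v₁ ζ-yᵢ noSwap (R̃ , over-RV , over-RD) =
  noSwap ( φ-aut (λ a → generated-intertwines generator-intertwines (generated a))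
                 g-injective g-surjective
         , intertwines⇒φ≈ z⋈z' , intertwines⇒φ≈ z'⋈z
         , λ i 2≤i → intertwines⇒φ≈ (yᵢ⋈yᵢ i 2≤i) )
  where
  open Group G

  i₀ i₁ : Fin n
  i₀ = Fin.zero
  i₁ = Fin.suc Fin.zero

  open LiftOfSwap n I G ζv R̃ over-RV over-RD i₀ (0∉I i₀ ≡.refl) (ζ-u₀ i₀ ≡.refl)

  z⋈z' : Intertwines z z'
  z⋈z' = resp-intertwines (ζ-u₁ i₁ ≡.refl) (ζ-v₁ i₁ ≡.refl) (voltage-intertwines u i₁)

  z'⋈z : Intertwines z' z
  z'⋈z = resp-intertwines (ζ-v₁ i₁ ≡.refl) (ζ-u₁ i₁ ≡.refl) (voltage-intertwines v i₁)

  yᵢ⋈yᵢ : ∀ i → 2 ≤ toℕ i → Intertwines (y i) (y i)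
  yᵢ⋈yᵢ i 2≤i = resp-intertwines (proj₁ (ζ-yᵢ i 2≤i)) (proj₂ (ζ-yᵢ i 2≤i)) (voltage-intertwines u i)

  Generator : Carrier → Set ℓ
  Generator x = x ≈ z ⊎ x ≈ z' ⊎ Σ (Fin n) (λ i → 2 ≤ toℕ i × x ≈ y i)

  generator-intertwines : ∀ {s} → Generator s → ∃ (Intertwines s)
  generator-intertwines (inj₁ s≈z)                     = z' , resp-intertwines (sym s≈z) refl z⋈z'
  generator-intertwines (inj₂ (inj₁ s≈z'))             = z , resp-intertwines (sym s≈z') refl z'⋈z
  generator-intertwines (inj₂ (inj₂ (i , 2≤i , s≈yᵢ))) = y i , resp-intertwines (sym s≈yᵢ) refl (yᵢ⋈yᵢ i 2≤i)
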